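{- Let $r \geq 2$ be an integer, let $A$ be a finite set of $k \geq 6$ positive integers, and let $H$ be a set of $t \geq 2$ positive integers with $(k-1)r-1 < \min(H) < \max(H) < kr$. Let $m_1=\lfloor \min(H)/r\rfloor$. If \[ |H^{(r)}A| = m_1 r(k-m_1)+(\min(H)-m_1 r)(k-2m_1-1)+t, \] then $H$ is an arithmetic progression with common difference $d \leq r-1$ and $A$ is an arithmetic progression with common difference $d\cdot\min(A)$.
   Context: For a finite set $A=\{a_1,\ldots,a_k\}$ of integers and positive integers $h, r$, $h^{(r)}A=\{\sum_{i=1}^k \lambda_i a_i : 0\le \lambda_i\le r,\ \sum_{i=1}^k\lambda_i=h\}$, and for a finite set $H$ of positive integers, $H^{(r)}A=\bigcup_{h\in H} h^{(r)}A$. A set is an arithmetic progression with common difference $d$ if it has the form $\{a, a+d, \ldots, a+(n-1)d\}$. -}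

module Defs where

open import Data.Nat using (ℕ; _+_; _*_; _≤_; _<_)
open import Data.Fin using (Fin)
open import Data.List using (List; length; tabulate; lookup)
open import Data.Nat.ListAction using (sum)
open import Data.List.Membership.Propositional using (_∈_)
open import Data.List.Relation.Unary.Unique.Propositional using (Unique)
open import Data.Product using (Σ; ∃; _×_)
open import Function.Bundles using (_⇔_)
open import Relation.Binary.PropositionalEquality using (_≡_)

-- A finite set of naturals is represented by a duplicate-free list.
-- Restricted h-fold sumset: x ∈ h^(r)A iff x = Σ λᵢ aᵢ with 0 ≤ λᵢ ≤ r, Σ λᵢ = h.
InRestrictedSumset : ℕ → ℕ → List ℕ → ℕ → Set
InRestrictedSumset h r A x =
  Σ (Fin (length A) → ℕ) λ c →
    (∀ i → c i ≤ r) ×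
    (sum (tabulate c) ≡ h) ×
    (sum (tabulate (λ i → c i * lookup A i)) ≡ x)

InHSumset : List ℕ → ℕ → List ℕ → ℕ → Set
InHSumset H r A x = Σ ℕ λ h → (h ∈ H) × InRestrictedSumset h r A x

HasCard : (ℕ → Set) → ℕ → Set
HasCard S n = Σ (List ℕ) λ L → Unique L × (length L ≡ n) × (∀ x → (x ∈ L) ⇔ S x)

IsAP : List ℕ → ℕ → Set
IsAP S d = ∃ λ a → ∀ x → (x ∈ S) ⇔ (∃ λ i → (i < length S) × (x ≡ a + i * d))

{-# OPTIONS --safe #-}
module Submission where

-- Put p = kr − min H and G = {kr − h : h ∈ H}, so that G ⊆ [1, p] and p ≤ r.
-- As all coefficients in h^(r)A are at most r, x ↦ r·ΣA − x maps H^(r)A onto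
-- the set D of sums Σ μₐ·a with 0 ≤ μₐ ≤ r and Σ μₐ ∈ G; since p ≤ r, D contains
-- every ordinary sumset gA with g ∈ G. Let a₀ < a₁ < ⋯ enumerate A. The |G|
-- multiples g·a₀ ≤ p·a₀ and the (k − 1)p elements (p − j)aᵢ + j·aᵢ₊₁ (1 ≤ j ≤ p)
-- of pA are distinct elements of D, and the hypothesis says |D| = |G| + (k − 1)p,
-- so D consists of exactly these. Now aᵢ + (p − 2)aᵢ₊₁ + aᵢ₊₂ ∈ pA forces
-- aᵢ₊₁ − aᵢ = aᵢ₊₂ − aᵢ₊₁ = δ; and for g ∈ G below p, (g − 1)a₀ + a₁ = g·a₀ + δ
-- is smaller than all the (p − j)aᵢ + j·aᵢ₊₁, so it is a multiple g′·a₀, g′ ∈ G.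
-- Hence δ = d·a₀ and G is closed under g ↦ g + d below p, so H is a progression
-- of difference d < p.

open import Defs
open import Data.Nat using (ℕ; _+_; _*_; _∸_; _≤_; _<_; _/_; NonZero)
open import Data.Integer as ℤ using (ℤ; +_)
open import Data.List using (List; length)
open import Data.List.Membership.Propositional using (_∈_)
open import Data.List.Relation.Unary.All using (All)
open import Data.List.Relation.Unary.Unique.Propositional using (Unique)
open import Data.Product using (Σ; ∃; _×_)
open import Relation.Binary.PropositionalEquality using (_≡_)

open import Algebra.Properties.CommutativeSemigroup using (interchange)
open import Data.Empty using (⊥-elim)
open import Data.Fin using (Fin)
import Data.Integer.Properties as ℤₚ
import Data.Integer.Tactic.RingSolver as ℤ-Ring
open import Data.List using ([]; _∷_; _++_; map; applyUpTo; tabulate; lookup)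
open import Data.List.Properties
  using (length-++; length-map; length-applyUpTo; length-removeAt′; map-cong; map-id; map-tabulate; tabulate-lookup)
open import Data.List.Membership.Propositional using (_∉_)
open import Data.List.Membership.Propositional.Properties using (∈-++⁻; ∈-map⁺; ∈-map⁻; ∈-applyUpTo⁺; ∈-applyUpTo⁻)
open import Data.List.Relation.Binary.Permutation.Propositional using (_↭_; ↭-sym; ↭⇒↭ₛ)
open import Data.List.Relation.Binary.Permutation.Propositional.Properties using (∈-resp-↭; ↭-length)
open import Data.List.Relation.Binary.Subset.Propositional using (_⊆_)
import Data.List.Relation.Unary.All as All
open import Data.List.Relation.Unary.All using ([]; _∷_)
import Data.List.Relation.Unary.All.Properties as Allₚ
open import Data.List.Relation.Unary.AllPairs using ([]; _∷_)
open import Data.List.Relation.Unary.Any using (here; there; index; _─_)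
import Data.List.Relation.Unary.Linked as Linked
open import Data.List.Relation.Unary.Linked using (Linked; []; [-]; _∷_)
open import Data.List.Relation.Unary.Linked.Properties using (Linked⇒All)
import Data.List.Relation.Unary.Unique.Propositional.Properties as Uniqueₚ
open import Data.Nat using (zero; suc; z≤n; s≤s; _≟_; >-nonZero)
open import Data.Nat.DivMod using (/-congˡ; +-distrib-/-∣ˡ; m*n/n≡m; m<n⇒m/n≡0)
open import Data.Nat.Divisibility using (n∣m*n)
open import Data.Nat.Induction using (<-rec)
open import Data.Nat.ListAction using (sum)
open import Data.Nat.Properties
open import Data.Nat.Tactic.RingSolver using (solve-∀)
open import Data.List.Membership.DecPropositional _≟_ using (_∈?_)
open import Data.List.Sort ≤-decTotalOrder using (sort; sort-↭; sort-↗)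
open import Data.Product using (_,_; proj₁; proj₂)
open import Data.Sum using (_⊎_; inj₁; inj₂)
open import Function using (id; _∘_)
open import Function.Bundles using (mk⇔; Equivalence)
open import Relation.Binary.Definitions using (DecidableEquality)
open import Relation.Binary.PropositionalEquality
  using (_≢_; refl; sym; trans; cong; cong₂; subst; setoid; module ≡-Reasoning)
open import Relation.Nullary using (yes; no)
open import Data.List.Relation.Binary.Permutation.Setoid.Properties (setoid ℕ) using (Unique-resp-↭)

module _ {X : Set} where

  ∈-─ : ∀ {x y} {ys : List X} (x∈ys : x ∈ ys) → y ∈ ys → y ≢ x → y ∈ (ys ─ x∈ys)
  ∈-─ (here refl) (here refl) y≢x = ⊥-elim (y≢x refl)
  ∈-─ (here _) (there y∈ys) _ = y∈ys
  ∈-─ (there _) (here y≡z) _ = here y≡z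
  ∈-─ (there x∈ys) (there y∈ys) y≢x = there (∈-─ x∈ys y∈ys y≢x)

  Unique-⊆⇒length≤ : ∀ {xs ys : List X} → Unique xs → xs ⊆ ys → length xs ≤ length ys
  Unique-⊆⇒length≤ {[]} _ _ = z≤n
  Unique-⊆⇒length≤ {x ∷ xs} {ys} (x∉xs ∷ uxs) xs⊆ys = begin
    suc (length xs)          ≤⟨ s≤s (Unique-⊆⇒length≤ uxs xs⊆ys─x) ⟩
    suc (length (ys ─ x∈ys)) ≡⟨ sym (length-removeAt′ ys (index x∈ys)) ⟩
    length ys                ∎
    where
    open ≤-Reasoning
    x∈ys = xs⊆ys (here refl)
    xs⊆ys─x : xs ⊆ (ys ─ x∈ys)
    xs⊆ys─x y∈xs = ∈-─ x∈ys (xs⊆ys (there y∈xs)) (λ y≡x → All.lookup x∉xs y∈xs (sym y≡x))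

  Linked-predecessor : ∀ {R : X → X → Set} {b bs x} → Linked R (b ∷ bs) → x ∈ bs → ∃ λ y → y ∈ b ∷ bs × R y x
  Linked-predecessor (Rbx ∷ _) (here refl) = _ , here refl , Rbx
  Linked-predecessor (_ ∷ lk) (there x∈bs) with Linked-predecessor lk x∈bs
  ... | y , y∈ , Ryx = y , there y∈ , Ryx

  module _ (_≟ₓ_ : DecidableEquality X) where

    another-element : ∀ {xs} → Unique xs → 2 ≤ length xs → ∀ x → ∃ λ y → y ∈ xs × y ≢ x
    another-element {y ∷ z ∷ _} ((y≢z ∷ _) ∷ _) _ x with y ≟ₓ x
    ... | yes refl = z , there (here refl) , y≢z ∘ sym
    ... | no y≢x = y , here refl , y≢x
    another-element {_ ∷ []} _ (s≤s ()) _

    module _ {P : X → Set} {n : ℕ} (bounded : ∀ {U} → Unique U → All P U → length U ≤ n) where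
      open import Data.List.Membership.DecPropositional _≟ₓ_ using () renaming (_∈?_ to _∈ₓ?_)

      maximal⇒complete : ∀ {U} → Unique U → All P U → length U ≡ n → ∀ {v} → P v → v ∈ U
      maximal⇒complete {U} uU PU |U|≡n {v} Pv with v ∈ₓ? U
      ... | yes v∈U = v∈U
      ... | no v∉U = ⊥-elim (<-irrefl |U|≡n (bounded (Allₚ.¬Any⇒All¬ U v∉U ∷ uU) (Pv ∷ PU)))

Linked-<-sort : ∀ {xs} → Unique xs → Linked _<_ (sort xs)
Linked-<-sort {xs} uxs = strict (sort-↗ xs) (Unique-resp-↭ (↭⇒↭ₛ (↭-sym (sort-↭ xs))) uxs)
  where
  strict : ∀ {ys} → Linked _≤_ ys → Unique ys → Linked _<_ ys
  strict [] _ = []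
  strict [-] _ = [-]
  strict (y≤z ∷ lk) ((y≢z ∷ _) ∷ u) = ≤∧≢⇒< y≤z y≢z ∷ strict lk u

increasing-enumeration : ∀ {xs} → Unique xs → 2 ≤ length xs →
  ∃ λ b₀ → ∃ λ b₁ → ∃ λ bs → Linked _<_ (b₀ ∷ b₁ ∷ bs) × (b₀ ∷ b₁ ∷ bs ↭ xs)
increasing-enumeration {xs} uxs 2≤|xs| with sort xs | sort-↭ xs | Linked-<-sort uxs
... | b₀ ∷ b₁ ∷ bs | B↭xs | B-increasing = b₀ , b₁ , bs , B-increasing , B↭xs
... | [] | B↭xs | _ = ⊥-elim (<⇒≱ 2≤|xs| (subst (_≤ 1) (↭-length B↭xs) z≤n))
... | _ ∷ [] | B↭xs | _ = ⊥-elim (<⇒≱ 2≤|xs| (subst (_≤ 1) (↭-length B↭xs) (s≤s z≤n)))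

Linked-head-minimum : ∀ {b bs x} → Linked _<_ (b ∷ bs) → x ∈ b ∷ bs → b ≤ x
Linked-head-minimum _ (here refl) = ≤-refl
Linked-head-minimum (b<c ∷ lk) (there x∈) = <⇒≤ (All.lookup (Linked⇒All <-trans b<c lk) x∈)

progression : ℕ → ℕ → ℕ → List ℕ
progression c d = applyUpTo (λ i → c + i * d)

Unique-progression : ∀ c {d} → 1 ≤ d → ∀ n → Unique (progression c d n)
Unique-progression c {d} 1≤d n =
  Uniqueₚ.applyUpTo⁺₁ _ n (λ i<j _ → <⇒≢ (+-monoʳ-< c (*-monoˡ-< d ⦃ >-nonZero 1≤d ⦄ i<j)))

length-progression : ∀ c d n → length (progression c d n) ≡ n
length-progression c d = length-applyUpTo (λ i → c + i * d)

progression-step : ∀ c i d → c + i * d + d ≡ c + suc i * d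
progression-step = solve-∀

module _ {S : List ℕ} {c d : ℕ} (uS : Unique S) (c∈S : c ∈ S) (1≤d : 1 ≤ d)
         (predecessor : ∀ {x} → x ∈ S → x ≢ c → ∃ λ y → y ∈ S × y + d ≡ x) where

  private
    index-of : ∀ x → x ∈ S → ∃ λ i → x ≡ c + i * d
    index-of = <-rec _ descend
      where
      descend : ∀ x → (∀ {y} → y < x → y ∈ S → ∃ λ i → y ≡ c + i * d) → x ∈ S → ∃ λ i → x ≡ c + i * d
      descend x rec x∈S with x ≟ c
      ... | yes refl = 0 , sym (+-identityʳ c)
      ... | no x≢c with predecessor x∈S x≢c
      ...   | y , y∈S , refl with rec (m<m+n y 1≤d) y∈S
      ...     | i , refl = suc i , progression-step c i d

    term≢c : ∀ i → c + suc i * d ≢ c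
    term≢c i x≡c = <-irrefl (sym x≡c) (m<m+n c (≤-trans 1≤d (m≤m+n d (i * d))))

    step-down : ∀ i → c + suc i * d ∈ S → c + i * d ∈ S
    step-down i x∈S with predecessor x∈S (term≢c i)
    ... | y , y∈S , y+d≡x =
      subst (_∈ S) (+-cancelʳ-≡ d y _ (trans y+d≡x (sym (progression-step c i d)))) y∈S

    downward : ∀ i {j} → j ≤ i → c + i * d ∈ S → c + j * d ∈ S
    downward zero z≤n = id
    downward (suc i) j≤1+i with m≤n⇒m<n∨m≡n j≤1+i
    ... | inj₁ j<1+i = downward i (≤-pred j<1+i) ∘ step-down i
    ... | inj₂ refl = id

    initial-segment⊆S : ∀ i → c + i * d ∈ S → progression c d (suc i) ⊆ S
    initial-segment⊆S i x∈S v∈ with ∈-applyUpTo⁻ (λ j → c + j * d) v∈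
    ... | j , j<1+i , refl = downward i (≤-pred j<1+i) x∈S

    S⊆initial-segment : ∀ i → c + i * d ∉ S → S ⊆ progression c d i
    S⊆initial-segment i x∉S {v} v∈S with index-of v v∈S
    ... | j , refl = ∈-applyUpTo⁺ (λ k → c + k * d) (≰⇒> (λ i≤j → x∉S (downward j i≤j v∈S)))

  predecessors⇒IsAP : IsAP S d
  predecessors⇒IsAP = c , λ x → mk⇔ (members x) (terms x)
    where
    members : ∀ x → x ∈ S → ∃ λ i → i < length S × x ≡ c + i * d
    members x x∈S with index-of x x∈S
    ... | i , refl = i , i<|S| , refl
      where
      i<|S| : i < length S
      i<|S| = subst (_≤ length S) (length-progression c d (suc i))
                (Unique-⊆⇒length≤ (Unique-progression c 1≤d (suc i)) (initial-segment⊆S i x∈S))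
    terms : ∀ x → (∃ λ i → i < length S × x ≡ c + i * d) → x ∈ S
    terms x (i , i<|S| , refl) with c + i * d ∈? S
    ... | yes x∈S = x∈S
    ... | no x∉S = ⊥-elim (<⇒≱ i<|S| (subst (length S ≤_) (length-progression c d i)
                     (Unique-⊆⇒length≤ uS (S⊆initial-segment i x∉S))))

weight : List (ℕ × ℕ) → ℕ
weight ts = sum (map proj₁ ts)

value : List (ℕ × ℕ) → ℕ
value ts = sum (map (λ t → proj₁ t * proj₂ t) ts)

SummandsIn : List ℕ → List (ℕ × ℕ) → Set
SummandsIn A = All (λ t → proj₂ t ∈ A)

pointMass : ℕ → ℕ → ℕ → ℕ
pointMass u c a with a ≟ u
... | yes _ = c
... | no _ = 0

multiplicity : List (ℕ × ℕ) → ℕ → ℕ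
multiplicity [] a = 0
multiplicity ((c , u) ∷ ts) a = pointMass u c a + multiplicity ts a

multiplicity≤weight : ∀ ts a → multiplicity ts a ≤ weight ts
multiplicity≤weight [] a = z≤n
multiplicity≤weight ((c , u) ∷ ts) a = +-mono-≤ (pointMass≤ u c a) (multiplicity≤weight ts a)
  where
  pointMass≤ : ∀ u c a → pointMass u c a ≤ c
  pointMass≤ u c a with a ≟ u
  ... | yes _ = ≤-refl
  ... | no _ = z≤n

module _ {X : Set} where

  sum-map-+ : ∀ (f g : X → ℕ) xs → sum (map (λ x → f x + g x) xs) ≡ sum (map f xs) + sum (map g xs)
  sum-map-+ f g [] = refl
  sum-map-+ f g (x ∷ xs) =
    trans (cong (_+_ (f x + g x)) (sum-map-+ f g xs)) (interchange +-commutativeSemigroup (f x) (g x) _ _)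

  sum-map-0 : ∀ (xs : List X) → sum (map (λ _ → 0) xs) ≡ 0
  sum-map-0 [] = refl
  sum-map-0 (x ∷ xs) = sum-map-0 xs

  sum-map-1 : ∀ (xs : List X) → sum (map (λ _ → 1) xs) ≡ length xs
  sum-map-1 [] = refl
  sum-map-1 (x ∷ xs) = cong suc (sum-map-1 xs)

  sum-map-*1 : ∀ (f : X → ℕ) xs → sum (map (λ x → f x * 1) xs) ≡ sum (map f xs)
  sum-map-*1 f xs = cong sum (map-cong (λ x → *-identityʳ (f x)) xs)

sum-pointMass-∉ : ∀ {u xs} c (f : ℕ → ℕ) → u ∉ xs → sum (map (λ a → pointMass u c a * f a) xs) ≡ 0
sum-pointMass-∉ {xs = []} c f _ = refl
sum-pointMass-∉ {u} {x ∷ xs} c f u∉ with x ≟ u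
... | yes refl = ⊥-elim (u∉ (here refl))
... | no _ = sum-pointMass-∉ c f (u∉ ∘ there)

sum-pointMass : ∀ {u xs} c (f : ℕ → ℕ) → Unique xs → u ∈ xs →
  sum (map (λ a → pointMass u c a * f a) xs) ≡ c * f u
sum-pointMass {u} {x ∷ xs} c f (x∉xs ∷ uxs) u∈ with x ≟ u | u∈
... | yes refl | _ = trans (cong (_+_ (c * f x)) (sum-pointMass-∉ c f (Allₚ.All¬⇒¬Any x∉xs))) (+-identityʳ _)
... | no x≢u | here u≡x = ⊥-elim (x≢u (sym u≡x))
... | no _ | there u∈xs = sum-pointMass c f uxs u∈xs

sum-multiplicity : ∀ {xs} → Unique xs → ∀ ts → SummandsIn xs ts → (f : ℕ → ℕ) →
  sum (map (λ a → multiplicity ts a * f a) xs) ≡ sum (map (λ t → proj₁ t * f (proj₂ t)) ts)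
sum-multiplicity {xs} _ [] [] f = sum-map-0 xs
sum-multiplicity {xs} uxs ((c , u) ∷ ts) (u∈xs ∷ ts⊆xs) f = begin
  sum (map (λ a → (pointMass u c a + multiplicity ts a) * f a) xs)
    ≡⟨ cong sum (map-cong (λ a → *-distribʳ-+ (f a) (pointMass u c a) (multiplicity ts a)) xs) ⟩
  sum (map (λ a → pointMass u c a * f a + multiplicity ts a * f a) xs)
    ≡⟨ sum-map-+ _ _ xs ⟩
  sum (map (λ a → pointMass u c a * f a) xs) + sum (map (λ a → multiplicity ts a * f a) xs)
    ≡⟨ cong₂ _+_ (sum-pointMass c f uxs u∈xs) (sum-multiplicity uxs ts ts⊆xs f) ⟩
  c * f u + sum (map (λ t → proj₁ t * f (proj₂ t)) ts) ∎
  where open ≡-Reasoning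

sum-complement : ∀ r (m f : ℕ → ℕ) xs → All (λ a → m a ≤ r) xs →
  sum (map (λ a → (r ∸ m a) * f a) xs) + sum (map (λ a → m a * f a) xs) ≡ r * sum (map f xs)
sum-complement r m f [] [] = sym (*-zeroʳ r)
sum-complement r m f (x ∷ xs) (mx≤r ∷ m≤r) = begin
  ((r ∸ m x) * f x + Σ-complement) + (m x * f x + Σ-m)
    ≡⟨ interchange +-commutativeSemigroup ((r ∸ m x) * f x) Σ-complement (m x * f x) Σ-m ⟩
  ((r ∸ m x) * f x + m x * f x) + (Σ-complement + Σ-m)
    ≡⟨ cong₂ _+_ complement-term (sum-complement r m f xs m≤r) ⟩
  r * f x + r * sum (map f xs)
    ≡⟨ sym (*-distribˡ-+ r (f x) _) ⟩
  r * (f x + sum (map f xs)) ∎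
  where
  open ≡-Reasoning
  Σ-complement = sum (map (λ a → (r ∸ m a) * f a) xs)
  Σ-m = sum (map (λ a → m a * f a) xs)
  complement-term : (r ∸ m x) * f x + m x * f x ≡ r * f x
  complement-term = trans (sym (*-distribʳ-+ (f x) (r ∸ m x) (m x))) (cong (_* f x) (m∸n+n≡m mx≤r))

+≡⇒≡∸ : ∀ {x y z} → x + y ≡ z → x ≡ z ∸ y
+≡⇒≡∸ {x} {y} x+y≡z = trans (sym (m+n∸n≡m x y)) (cong (_∸ y) x+y≡z)

restrictedSumset-complement : ∀ {A} → Unique A → ∀ r ts → SummandsIn A ts → weight ts ≤ r →
  value ts ≤ r * sum A × InRestrictedSumset (length A * r ∸ weight ts) r A (r * sum A ∸ value ts)
restrictedSumset-complement {A} uA r ts ts⊆A w≤r =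
  value≤ , coefficient , (λ i → m∸n≤m r (m (lookup A i))) , count , total
  where
  m = multiplicity ts
  m≤r : All (λ a → m a ≤ r) A
  m≤r = All.tabulate (λ _ → ≤-trans (multiplicity≤weight ts _) w≤r)
  coefficient : Fin (length A) → ℕ
  coefficient i = r ∸ m (lookup A i)
  sum-over-A : ∀ (F : ℕ → ℕ) → sum (tabulate (F ∘ lookup A)) ≡ sum (map F A)
  sum-over-A F = cong sum (trans (sym (map-tabulate (lookup A) F)) (cong (map F) (tabulate-lookup A)))
  complement : ∀ f →
    sum (map (λ a → (r ∸ m a) * f a) A) + sum (map (λ t → proj₁ t * f (proj₂ t)) ts) ≡ r * sum (map f A)
  complement f = trans (cong (_+_ _) (sym (sum-multiplicity uA ts ts⊆A f))) (sum-complement r m f A m≤r)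
  value≤ : value ts ≤ r * sum A
  value≤ = subst (value ts ≤_) (trans (complement id) (cong (λ xs → r * sum xs) (map-id A))) (m≤n+m _ _)
  count : sum (tabulate coefficient) ≡ length A * r ∸ weight ts
  count = trans (sum-over-A (λ a → r ∸ m a)) (+≡⇒≡∸ (begin
    sum (map (λ a → r ∸ m a) A) + weight ts
      ≡⟨ sym (cong₂ _+_ (sum-map-*1 (λ a → r ∸ m a) A) (sum-map-*1 proj₁ ts)) ⟩
    sum (map (λ a → (r ∸ m a) * 1) A) + sum (map (λ t → proj₁ t * 1) ts)
      ≡⟨ complement (λ _ → 1) ⟩
    r * sum (map (λ _ → 1) A)
      ≡⟨ trans (cong (r *_) (sum-map-1 A)) (*-comm r (length A)) ⟩
    length A * r ∎))
    where open ≡-Reasoning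
  total : sum (tabulate (λ i → coefficient i * lookup A i)) ≡ r * sum A ∸ value ts
  total = trans (sum-over-A (λ a → (r ∸ m a) * a))
            (+≡⇒≡∸ (trans (complement id) (cong (λ xs → r * sum xs) (map-id A))))

Unique-map-∸ : ∀ {m xs} → All (_≤ m) xs → Unique xs → Unique (map (m ∸_) xs)
Unique-map-∸ [] [] = []
Unique-map-∸ (x≤m ∷ xs≤m) (x∉xs ∷ uxs) =
  Allₚ.map⁺ (All.zipWith (λ (y≤m , x≢y) eq → x≢y (∸-cancelˡ-≡ x≤m y≤m eq)) (xs≤m , x∉xs)) ∷ Unique-map-∸ xs≤m uxs

Deficit : ℕ → List ℕ → List ℕ → ℕ → Set
Deficit r H A v = v ≤ r * sum A × InHSumset H r A (r * sum A ∸ v)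

Deficit-value : ∀ {r A H} → Unique A → ∀ ts → SummandsIn A ts → weight ts ≤ r →
  length A * r ∸ weight ts ∈ H → Deficit r H A (value ts)
Deficit-value {r} uA ts ts⊆A w≤r h∈H with restrictedSumset-complement uA r ts ts⊆A w≤r
... | value≤ , x∈h^rA = value≤ , _ , h∈H , x∈h^rA

Deficits-bounded : ∀ {r A H n} → HasCard (InHSumset H r A) n →
  ∀ {U} → Unique U → All (Deficit r H A) U → length U ≤ n
Deficits-bounded {r} {A} (L , _ , refl , L≡H^rA) {U} uU DU = begin
  length U                      ≡⟨ sym (length-map (r * sum A ∸_) U) ⟩
  length (map (r * sum A ∸_) U) ≤⟨ Unique-⊆⇒length≤ (Unique-map-∸ (All.map proj₁ DU) uU) complements⊆L ⟩
  length L                      ∎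
  where
  open ≤-Reasoning
  complements⊆L : map (r * sum A ∸_) U ⊆ L
  complements⊆L x∈ with ∈-map⁻ (r * sum A ∸_) x∈
  ... | v , v∈U , refl = Equivalence.from (L≡H^rA _) (proj₂ (All.lookup DU v∈U))

middle-identities : ∀ q {x y z} d₁ d₂ → x + d₁ ≡ y → y + d₂ ≡ z →
  (x + q * y + z ≡ (2 + q) * x + d₁ + (q * d₁ + d₂)) ×
  (x + q * y + z + d₁ ≡ (2 + q) * y + d₂) ×
  (x + q * y + z + (d₁ + suc q * d₂) ≡ (2 + q) * z)
middle-identities q {x} d₁ d₂ refl refl = lhs-at-x q x d₁ d₂ , lhs-at-y q x d₁ d₂ , lhs-at-z q x d₁ d₂
  where
  lhs-at-x : ∀ q x d₁ d₂ → x + q * (x + d₁) + (x + d₁ + d₂) ≡ (2 + q) * x + d₁ + (q * d₁ + d₂)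
  lhs-at-x = solve-∀
  lhs-at-y : ∀ q x d₁ d₂ → x + q * (x + d₁) + (x + d₁ + d₂) + d₁ ≡ (2 + q) * (x + d₁) + d₂
  lhs-at-y = solve-∀
  lhs-at-z : ∀ q x d₁ d₂ → x + q * (x + d₁) + (x + d₁ + d₂) + (d₁ + suc q * d₂) ≡ (2 + q) * (x + d₁ + d₂)
  lhs-at-z = solve-∀

module Chain (q : ℕ) where

  p : ℕ
  p = 2 + q

  block : ℕ → ℕ → List ℕ
  block x δ = progression (p * x + δ) δ p

  -- The elements p·x + j·(y − x) = (p − j)·x + j·y, 1 ≤ j ≤ p, of the p-fold
  -- sumset, for consecutive x < y, listed block by block in increasing order.
  chain : List ℕ → List ℕ
  chain (x ∷ y ∷ xs) = block x (y ∸ x) ++ chain (y ∷ xs)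
  chain _ = []

  block-bounds : ∀ x δ {v} → v ∈ block x δ → p * x + δ ≤ v × v ≤ p * x + p * δ
  block-bounds x δ v∈ with ∈-applyUpTo⁻ (λ i → p * x + δ + i * δ) v∈
  ... | i , i<p , refl = m≤m+n _ _ , (begin
    p * x + δ + i * δ   ≡⟨ +-assoc (p * x) δ (i * δ) ⟩
    p * x + suc i * δ   ≤⟨ +-monoʳ-≤ (p * x) (*-monoˡ-≤ δ i<p) ⟩
    p * x + p * δ       ∎)
    where open ≤-Reasoning

  p*gap : ∀ {x y} → x ≤ y → p * x + p * (y ∸ x) ≡ p * y
  p*gap {x} {y} x≤y = trans (sym (*-distribˡ-+ p x (y ∸ x))) (cong (p *_) (m+[n∸m]≡n x≤y))

  block-upper : ∀ {x y v} → x ≤ y → v ∈ block x (y ∸ x) → v ≤ p * y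
  block-upper {x} {y} x≤y v∈ = ≤-trans (proj₂ (block-bounds x (y ∸ x) v∈)) (≤-reflexive (p*gap x≤y))

  chain-above : ∀ {x xs v} → Linked _<_ (x ∷ xs) → v ∈ chain (x ∷ xs) → p * x < v
  chain-above {x} {y ∷ _} (x<y ∷ lk) v∈ with ∈-++⁻ (block x (y ∸ x)) v∈
  ... | inj₁ v∈b = <-≤-trans (m<m+n (p * x) (m<n⇒0<n∸m x<y)) (proj₁ (block-bounds x (y ∸ x) v∈b))
  ... | inj₂ v∈c = <-trans (*-monoʳ-< p x<y) (chain-above lk v∈c)

  chain-lower : ∀ {x y xs v} → Linked _<_ (x ∷ y ∷ xs) → v ∈ chain (x ∷ y ∷ xs) → p * x + (y ∸ x) ≤ v
  chain-lower {x} {y} (x<y ∷ lk) v∈ with ∈-++⁻ (block x (y ∸ x)) v∈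
  ... | inj₁ v∈b = proj₁ (block-bounds x (y ∸ x) v∈b)
  ... | inj₂ v∈c = begin
    p * x + (y ∸ x)     ≤⟨ +-monoʳ-≤ (p * x) (m≤n*m (y ∸ x) p) ⟩
    p * x + p * (y ∸ x) ≡⟨ p*gap (<⇒≤ x<y) ⟩
    p * y               <⟨ chain-above lk v∈c ⟩
    _                   ∎
    where open ≤-Reasoning

  chain-skip : ∀ {x y xs v} → Linked _<_ (x ∷ y ∷ xs) → v ∈ chain (x ∷ y ∷ xs) → p * y < v → v ∈ chain (y ∷ xs)
  chain-skip {x} {y} (x<y ∷ _) v∈ py<v with ∈-++⁻ (block x (y ∸ x)) v∈
  ... | inj₁ v∈b = ⊥-elim (<⇒≱ py<v (block-upper (<⇒≤ x<y) v∈b))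
  ... | inj₂ v∈c = v∈c

  Unique-chain : ∀ {xs} → Linked _<_ xs → Unique (chain xs)
  Unique-chain [] = []
  Unique-chain [-] = []
  Unique-chain {x ∷ y ∷ _} (x<y ∷ lk) =
    Uniqueₚ.++⁺ (Unique-progression _ (m<n⇒0<n∸m x<y) p) (Unique-chain lk)
      (λ (v∈b , v∈c) → <⇒≱ (chain-above lk v∈c) (block-upper (<⇒≤ x<y) v∈b))

  length-chain : ∀ x xs → length (chain (x ∷ xs)) ≡ length xs * p
  length-chain x [] = refl
  length-chain x (y ∷ xs) =
    trans (length-++ (block x (y ∸ x)))
      (cong₂ _+_ (length-progression (p * x + (y ∸ x)) (y ∸ x) p) (length-chain y xs))

  All-chain : ∀ {P Q : ℕ → Set} {xs} → Linked _<_ xs → All Q xs →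
    (∀ {x y} → Q x → Q y → x < y → ∀ {i} → i < p → P (p * x + (y ∸ x) + i * (y ∸ x))) → All P (chain xs)
  All-chain [] _ _ = []
  All-chain [-] _ _ = []
  All-chain (x<y ∷ lk) (Qx ∷ Qys@(Qy ∷ _)) P-block =
    Allₚ.++⁺ (Allₚ.applyUpTo⁺₁ _ p (P-block Qx Qy x<y)) (All-chain lk Qys P-block)

  middle-above : ∀ {x y z} → x < y → y < z → p * x < x + q * y + z
  middle-above {x} {y} {z} x<y y<z = begin-strict
    p * x         ≡⟨ +-comm x (x + q * x) ⟩
    x + q * x + x <⟨ +-mono-≤-< (+-monoʳ-≤ x (*-monoʳ-≤ q (<⇒≤ x<y))) (<-trans x<y y<z) ⟩
    x + q * y + z ∎
    where open ≤-Reasoning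

  -- x + q·y + z = p·y − (y − x) + (z − y) lies above p·x, below the block of
  -- (y, z) and below p·z; in the block of (x, y) only its top p·y can equal it.
  middle-forced : ∀ {x y z xs} → Linked _<_ (x ∷ y ∷ z ∷ xs) →
    x + q * y + z ∈ chain (x ∷ y ∷ z ∷ xs) → y ∸ x ≡ z ∸ y
  middle-forced {x} {y} {z} {xs} (x<y ∷ y<z ∷ lk) W∈ = locate (∈-++⁻ (block x d₁) W∈)
    where
    d₁ = y ∸ x
    d₂ = z ∸ y
    W = x + q * y + z
    identities = middle-identities q d₁ d₂ (m+[n∸m]≡n (<⇒≤ x<y)) (m+[n∸m]≡n (<⇒≤ y<z))
    W<py+d₂ : W < p * y + d₂
    W<py+d₂ = subst (W <_) (proj₁ (proj₂ identities)) (m<m+n W (m<n⇒0<n∸m x<y))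
    W≤pz : W ≤ p * z
    W≤pz = subst (W ≤_) (proj₂ (proj₂ identities)) (m≤m+n W _)
    forced-index : ∀ {i} → i < p → q * d₁ + d₂ ≡ i * d₁ → d₁ ≡ d₂
    forced-index i<p eq with m≤n⇒m<n∨m≡n (≤-pred i<p)
    ... | inj₂ refl = sym (+-cancelˡ-≡ (q * d₁) d₂ d₁ (trans eq (+-comm d₁ (q * d₁))))
    ... | inj₁ i<1+q = ⊥-elim (<⇒≱ (m<m+n (q * d₁) (m<n⇒0<n∸m y<z))
                         (subst (_≤ q * d₁) (sym eq) (*-monoˡ-≤ d₁ (≤-pred i<1+q))))
    locate : W ∈ block x d₁ ⊎ W ∈ chain (y ∷ z ∷ xs) → d₁ ≡ d₂
    locate (inj₁ W∈bx) with ∈-applyUpTo⁻ (λ i → p * x + d₁ + i * d₁) W∈bx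
    ... | i , i<p , W≡ = forced-index i<p (+-cancelˡ-≡ (p * x + d₁) _ _ (trans (sym (proj₁ identities)) W≡))
    locate (inj₂ W∈c) with ∈-++⁻ (block y d₂) W∈c
    ... | inj₁ W∈by = ⊥-elim (<⇒≱ W<py+d₂ (proj₁ (block-bounds y d₂ W∈by)))
    ... | inj₂ W∈c′ = ⊥-elim (<⇒≱ (chain-above lk W∈c′) W≤pz)

two-point-value : ∀ {e i x y δ p} → e + suc i ≡ p → x + δ ≡ y → e * x + (suc i * y + 0) ≡ p * x + δ + i * δ
two-point-value {e} {i} {x} {δ = δ} refl refl = identity e i x δ
  where
  identity : ∀ e i x δ → e * x + (suc i * (x + δ) + 0) ≡ (e + suc i) * x + δ + i * δ
  identity = solve-∀

shifted-value : ∀ {g b b′ δ} → 1 ≤ g → b + δ ≡ b′ → (g ∸ 1) * b + (1 * b′ + 0) ≡ g * b + δ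
shifted-value {suc g} {b} {δ = δ} _ refl = identity g b δ
  where
  identity : ∀ g b δ → g * b + (1 * (b + δ) + 0) ≡ suc g * b + δ
  identity = solve-∀

middle-value : ∀ q x y z → 1 * x + (q * y + (1 * z + 0)) ≡ x + q * y + z
middle-value = solve-∀

difference-of-multiples : ∀ g₀ g₁ b {δ} → g₁ * b ≡ g₀ * b + δ → δ ≡ (g₁ ∸ g₀) * b
difference-of-multiples g₀ g₁ b {δ} eq = begin
  δ                   ≡⟨ sym (m+n∸m≡n (g₀ * b) δ) ⟩
  g₀ * b + δ ∸ g₀ * b ≡⟨ cong (_∸ g₀ * b) (sym eq) ⟩
  g₁ * b ∸ g₀ * b     ≡⟨ sym (*-distribʳ-∸ b g₁ g₀) ⟩
  (g₁ ∸ g₀) * b       ∎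
  where open ≡-Reasoning

module UnionOfSumsets
  {A : List ℕ} (uA : Unique A) {b₀ b₁ : ℕ} {bs : List ℕ}
  (B-increasing : Linked _<_ (b₀ ∷ b₁ ∷ bs)) (B↭A : b₀ ∷ b₁ ∷ bs ↭ A) (1≤b₀ : 1 ≤ b₀)
  {G : List ℕ} (uG : Unique G) (q : ℕ) (G≥1 : All (1 ≤_) G) (G≤p : All (_≤ 2 + q) G) (p∈G : 2 + q ∈ G)
  (D : ℕ → Set) (sums⊆D : ∀ ts → weight ts ∈ G → SummandsIn A ts → D (value ts))
  (bounded : ∀ {U} → Unique U → All D U → length U ≤ length G + (length A ∸ 1) * (2 + q))
  where

  open Chain q

  private
    instance
      b₀-nonZero : NonZero b₀
      b₀-nonZero = >-nonZero 1≤b₀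

  B : List ℕ
  B = b₀ ∷ b₁ ∷ bs

  δ : ℕ
  δ = b₁ ∸ b₀

  b₀<b₁ : b₀ < b₁
  b₀<b₁ = Linked.head B-increasing

  B⊆A : B ⊆ A
  B⊆A = ∈-resp-↭ B↭A

  A⊆B : A ⊆ B
  A⊆B = ∈-resp-↭ (↭-sym B↭A)

  D-sum : ∀ {g v} ts → g ∈ G → weight ts ≡ g → value ts ≡ v → SummandsIn A ts → D v
  D-sum ts g∈G refl refl = sums⊆D ts g∈G

  multiples : List ℕ
  multiples = map (_* b₀) G

  U₀ : List ℕ
  U₀ = multiples ++ chain B

  multiple≤pb₀ : ∀ {v} → v ∈ multiples → v ≤ p * b₀
  multiple≤pb₀ v∈ with ∈-map⁻ (_* b₀) v∈
  ... | g , g∈G , refl = *-monoˡ-≤ b₀ (All.lookup G≤p g∈G)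

  Unique-U₀ : Unique U₀
  Unique-U₀ = Uniqueₚ.++⁺ (Uniqueₚ.map⁺ (λ {g} {g′} → *-cancelʳ-≡ g g′ b₀) uG) (Unique-chain B-increasing)
    (λ (v∈m , v∈c) → <⇒≱ (chain-above B-increasing v∈c) (multiple≤pb₀ v∈m))

  D-U₀ : All D U₀
  D-U₀ = Allₚ.++⁺ (Allₚ.map⁺ (All.tabulate multiple∈D)) (All-chain B-increasing (All.tabulate B⊆A) block∈D)
    where
    multiple∈D : ∀ {g} → g ∈ G → D (g * b₀)
    multiple∈D {g} g∈G = D-sum ((g , b₀) ∷ []) g∈G (+-identityʳ g) (+-identityʳ (g * b₀)) (B⊆A (here refl) ∷ [])
    block∈D : ∀ {x y} → x ∈ A → y ∈ A → x < y → ∀ {i} → i < p → D (p * x + (y ∸ x) + i * (y ∸ x))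
    block∈D {x} {y} x∈A y∈A x<y {i} i<p =
      D-sum ((p ∸ suc i , x) ∷ (suc i , y) ∷ []) p∈G
        (trans (cong (_+_ (p ∸ suc i)) (+-identityʳ (suc i))) (m∸n+n≡m i<p))
        (two-point-value (m∸n+n≡m i<p) (m+[n∸m]≡n (<⇒≤ x<y))) (x∈A ∷ y∈A ∷ [])

  length-U₀ : length U₀ ≡ length G + (length A ∸ 1) * p
  length-U₀ = trans (length-++ multiples) (cong₂ _+_ (length-map (_* b₀) G)
    (trans (length-chain b₀ (b₁ ∷ bs)) (cong (λ k → (k ∸ 1) * p) (↭-length B↭A))))

  D⊆U₀ : ∀ {v} → D v → v ∈ U₀
  D⊆U₀ = maximal⇒complete _≟_ bounded Unique-U₀ D-U₀ length-U₀

  D-above⊆chain : ∀ {v} → D v → p * b₀ < v → v ∈ chain B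
  D-above⊆chain Dv pb₀<v with ∈-++⁻ multiples (D⊆U₀ Dv)
  ... | inj₁ v∈m = ⊥-elim (<⇒≱ pb₀<v (multiple≤pb₀ v∈m))
  ... | inj₂ v∈c = v∈c

  equal-gaps : ∀ {x y xs} → Linked _<_ (x ∷ y ∷ xs) → (x ∷ y ∷ xs) ⊆ A →
    (∀ {v} → D v → p * x < v → v ∈ chain (x ∷ y ∷ xs)) →
    Linked (λ u w → u + (y ∸ x) ≡ w) (x ∷ y ∷ xs)
  equal-gaps (x<y ∷ [-]) _ _ = m+[n∸m]≡n (<⇒≤ x<y) ∷ [-]
  equal-gaps {x} {y} {z ∷ xs} (x<y ∷ lk) S⊆A covers =
    m+[n∸m]≡n (<⇒≤ x<y) ∷
      subst (λ γ → Linked (λ u w → u + γ ≡ w) (y ∷ z ∷ xs)) (sym gaps≡) (equal-gaps lk (S⊆A ∘ there) covers′)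
    where
    y<z = Linked.head lk
    middle∈D : D (x + q * y + z)
    middle∈D = D-sum ((1 , x) ∷ (q , y) ∷ (1 , z) ∷ []) p∈G (cong suc (+-comm q 1)) (middle-value q x y z)
      (S⊆A (here refl) ∷ S⊆A (there (here refl)) ∷ S⊆A (there (there (here refl))) ∷ [])
    gaps≡ : y ∸ x ≡ z ∸ y
    gaps≡ = middle-forced (x<y ∷ lk) (covers middle∈D (middle-above x<y y<z))
    covers′ : ∀ {v} → D v → p * y < v → v ∈ chain (y ∷ z ∷ xs)
    covers′ Dv py<v = chain-skip (x<y ∷ lk) (covers Dv (<-trans (*-monoʳ-< p x<y) py<v)) py<v

  A-predecessor : ∀ {x} → x ∈ A → x ≢ b₀ → ∃ λ y → y ∈ A × y + δ ≡ x
  A-predecessor x∈A x≢b₀ with A⊆B x∈A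
  ... | here x≡b₀ = ⊥-elim (x≢b₀ x≡b₀)
  ... | there x∈bs with Linked-predecessor (equal-gaps B-increasing B⊆A D-above⊆chain) x∈bs
  ...   | y , y∈B , y+δ≡x = y , B⊆A y∈B , y+δ≡x

  gap-step : ∀ {g} → g ∈ G → g ≢ p → ∃ λ g′ → g′ ∈ G × g′ * b₀ ≡ g * b₀ + δ
  gap-step {g} g∈G g≢p = locate (∈-++⁻ multiples (D⊆U₀ shifted∈D))
    where
    1≤g = All.lookup G≥1 g∈G
    shifted∈D : D (g * b₀ + δ)
    shifted∈D = D-sum ((g ∸ 1 , b₀) ∷ (1 , b₁) ∷ []) g∈G (m∸n+n≡m 1≤g)
      (shifted-value 1≤g (m+[n∸m]≡n (<⇒≤ b₀<b₁))) (B⊆A (here refl) ∷ B⊆A (there (here refl)) ∷ [])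
    below-chain : g * b₀ + δ < p * b₀ + δ
    below-chain = +-monoˡ-< δ (*-monoˡ-< b₀ (≤∧≢⇒< (All.lookup G≤p g∈G) g≢p))
    locate : g * b₀ + δ ∈ multiples ⊎ g * b₀ + δ ∈ chain B → ∃ λ g′ → g′ ∈ G × g′ * b₀ ≡ g * b₀ + δ
    locate (inj₁ v∈m) with ∈-map⁻ (_* b₀) v∈m
    ... | g′ , g′∈G , v≡ = g′ , g′∈G , sym v≡
    locate (inj₂ v∈c) = ⊥-elim (<⇒≱ below-chain (chain-lower B-increasing v∈c))

  inverse : ∀ {g₀} → g₀ ∈ G → g₀ ≢ p →
    ∃ λ d → 1 ≤ d × d < p × IsAP A (d * b₀) × (∀ {g} → g ∈ G → g ≢ p → g + d ∈ G)
  inverse {g₀} g₀∈G g₀≢p with gap-step g₀∈G g₀≢p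
  ... | g₁ , g₁∈G , g₁b₀≡ = g₁ ∸ g₀ , m<n⇒0<n∸m g₀<g₁ , d<p , apA , G-step
    where
    d = g₁ ∸ g₀
    δ≡ : δ ≡ d * b₀
    δ≡ = difference-of-multiples g₀ g₁ b₀ g₁b₀≡
    g₀<g₁ : g₀ < g₁
    g₀<g₁ = *-cancelʳ-< b₀ g₀ g₁ (subst (g₀ * b₀ <_) (sym g₁b₀≡) (m<m+n (g₀ * b₀) (m<n⇒0<n∸m b₀<b₁)))
    d<p : d < p
    d<p = <-≤-trans (∸-monoʳ-< (All.lookup G≥1 g₀∈G) (<⇒≤ g₀<g₁)) (All.lookup G≤p g₁∈G)
    apA : IsAP A (d * b₀)
    apA = subst (IsAP A) δ≡ (predecessors⇒IsAP uA (B⊆A (here refl)) (m<n⇒0<n∸m b₀<b₁) A-predecessor)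
    G-step : ∀ {g} → g ∈ G → g ≢ p → g + d ∈ G
    G-step {g} g∈G g≢p with gap-step g∈G g≢p
    ... | g′ , g′∈G , g′b₀≡ = subst (_∈ G) (*-cancelʳ-≡ g′ (g + d) b₀
            (trans g′b₀≡ (trans (cong (_+_ (g * b₀)) δ≡) (sym (*-distribʳ-+ b₀ g d))))) g′∈G

complement-predecessor : ∀ {m h h′ d} → h ≤ m → h′ ≤ m → m ∸ h + d ≡ m ∸ h′ → h′ + d ≡ h
complement-predecessor {m} {h} {h′} {d} h≤m h′≤m eq = +-cancelʳ-≡ (m ∸ h) (h′ + d) h (begin
  h′ + d + (m ∸ h)   ≡⟨ +-assoc h′ d (m ∸ h) ⟩
  h′ + (d + (m ∸ h)) ≡⟨ cong (_+_ h′) (trans (+-comm d (m ∸ h)) eq) ⟩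
  h′ + (m ∸ h′)      ≡⟨ m+[n∸m]≡n h′≤m ⟩
  m                  ≡⟨ sym (m+[n∸m]≡n h≤m) ⟩
  h + (m ∸ h)        ∎)
  where open ≡-Reasoning

inverse-in-top-window : ∀ {r A H hmin h₂ amin q n} →
  Unique A → All (1 ≤_) A → 2 ≤ length A → amin ∈ A → All (amin ≤_) A →
  Unique H → hmin ∈ H → All (hmin ≤_) H → All (_< length A * r) H → h₂ ∈ H → h₂ ≢ hmin →
  hmin + (2 + q) ≡ length A * r → 2 + q ≤ r →
  HasCard (InHSumset H r A) n → n ≡ length H + (length A ∸ 1) * (2 + q) →
  ∃ λ d → d < 2 + q × IsAP H d × IsAP A (d * amin)
inverse-in-top-window {r} {A} {H} {hmin} {h₂} {amin} {q} {n}
  uA A≥1 2≤k amin∈A amin≤A uH hmin∈H hmin≤H H<kr h₂∈H h₂≢hmin window p≤r card n≡ =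
  conclude (increasing-enumeration uA 2≤k)
  where
  kr = length A * r
  G = map (kr ∸_) H
  h≤kr : ∀ {h} → h ∈ H → h ≤ kr
  h≤kr h∈H = <⇒≤ (All.lookup H<kr h∈H)
  p≡ : kr ∸ hmin ≡ 2 + q
  p≡ = trans (cong (_∸ hmin) (sym window)) (m+n∸m≡n hmin (2 + q))
  gap≢p : ∀ {h} → h ∈ H → h ≢ hmin → kr ∸ h ≢ 2 + q
  gap≢p h∈H h≢hmin eq = h≢hmin (∸-cancelˡ-≡ (h≤kr h∈H) (h≤kr hmin∈H) (trans eq (sym p≡)))
  uG : Unique G
  uG = Unique-map-∸ (All.map <⇒≤ H<kr) uH
  G≥1 : All (1 ≤_) G
  G≥1 = Allₚ.map⁺ (All.map m<n⇒0<n∸m H<kr)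
  G≤p : All (_≤ 2 + q) G
  G≤p = Allₚ.map⁺ (All.map (λ {h} hmin≤h → subst (kr ∸ h ≤_) p≡ (∸-monoʳ-≤ kr hmin≤h)) hmin≤H)
  p∈G : 2 + q ∈ G
  p∈G = subst (_∈ G) p≡ (∈-map⁺ (kr ∸_) hmin∈H)
  sums⊆D : ∀ ts → weight ts ∈ G → SummandsIn A ts → Deficit r H A (value ts)
  sums⊆D ts w∈G ts⊆A with ∈-map⁻ (kr ∸_) w∈G
  ... | h , h∈H , w≡ = Deficit-value uA ts ts⊆A
    (≤-trans (≤-reflexive w≡) (≤-trans (All.lookup G≤p (∈-map⁺ (kr ∸_) h∈H)) p≤r))
    (subst (_∈ H) (sym (trans (cong (kr ∸_) w≡) (m∸[m∸n]≡n (h≤kr h∈H)))) h∈H)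
  bounded : ∀ {U} → Unique U → All (Deficit r H A) U → length U ≤ length G + (length A ∸ 1) * (2 + q)
  bounded uU DU = ≤-trans (Deficits-bounded {r} {A} {H} card uU DU)
    (≤-reflexive (trans n≡ (cong (_+ (length A ∸ 1) * (2 + q)) (sym (length-map (kr ∸_) H)))))
  conclude : (∃ λ b₀ → ∃ λ b₁ → ∃ λ bs → Linked _<_ (b₀ ∷ b₁ ∷ bs) × (b₀ ∷ b₁ ∷ bs ↭ A)) →
    ∃ λ d → d < 2 + q × IsAP H d × IsAP A (d * amin)
  conclude (b₀ , b₁ , bs , B-increasing , B↭A) = finish (UnionOfSumsets.inverse uA B-increasing B↭A
    (All.lookup A≥1 (∈-resp-↭ B↭A (here refl))) uG q G≥1 G≤p p∈G (Deficit r H A) sums⊆D bounded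
    (∈-map⁺ (kr ∸_) h₂∈H) (gap≢p h₂∈H h₂≢hmin))
    where
    b₀≡amin : b₀ ≡ amin
    b₀≡amin = ≤-antisym (Linked-head-minimum B-increasing (∈-resp-↭ (↭-sym B↭A) amin∈A))
                        (All.lookup amin≤A (∈-resp-↭ B↭A (here refl)))
    finish : (∃ λ d → 1 ≤ d × d < 2 + q × IsAP A (d * b₀) × (∀ {g} → g ∈ G → g ≢ 2 + q → g + d ∈ G)) →
      ∃ λ d → d < 2 + q × IsAP H d × IsAP A (d * amin)
    finish (d , 1≤d , d<p , apA , G-step) =
      d , d<p , predecessors⇒IsAP uH hmin∈H 1≤d H-predecessor , subst (λ b → IsAP A (d * b)) b₀≡amin apA
      where
      H-predecessor : ∀ {h} → h ∈ H → h ≢ hmin → ∃ λ h′ → h′ ∈ H × h′ + d ≡ h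
      H-predecessor h∈H h≢hmin with ∈-map⁻ (kr ∸_) (G-step (∈-map⁺ (kr ∸_) h∈H) (gap≢p h∈H h≢hmin))
      ... | h′ , h′∈H , eq = h′ , h′∈H , complement-predecessor (h≤kr h∈H) (h≤kr h′∈H) eq

∸1<⇒≤ : ∀ {m n} → m ∸ 1 < n → m ≤ n
∸1<⇒≤ {zero} _ = z≤n
∸1<⇒≤ {suc m} m<n = m<n

<⇒≤∸1 : ∀ {m n} → m < n → m ≤ n ∸ 1
<⇒≤∸1 (s≤s m≤n) = m≤n

top-window-decomposition : ∀ {k r hmin h} → (k ∸ 1) * r ≤ hmin → hmin < h → h < k * r →
  ∃ λ q → ∃ λ e → hmin + (2 + q) ≡ k * r × hmin ≡ (k ∸ 1) * r + e × r ≡ e + (2 + q) × 2 + q ≤ r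
top-window-decomposition {zero} _ _ ()
top-window-decomposition {suc k′} {r} {hmin} k′r≤hmin hmin<h h<kr =
  q , e , window , hmin≡ , r≡ , subst (2 + q ≤_) (sym r≡) (m≤n+m _ e)
  where
  q = suc k′ * r ∸ (hmin + 2)
  e = hmin ∸ k′ * r
  window : hmin + (2 + q) ≡ suc k′ * r
  window = trans (sym (+-assoc hmin 2 q))
             (m+[n∸m]≡n (subst (_≤ suc k′ * r) (+-comm 2 hmin) (≤-trans (s≤s hmin<h) h<kr)))
  hmin≡ : hmin ≡ k′ * r + e
  hmin≡ = sym (m+[n∸m]≡n k′r≤hmin)
  r≡ : r ≡ e + (2 + q)
  r≡ = +-cancelˡ-≡ (k′ * r) r (e + (2 + q)) (begin
    k′ * r + r           ≡⟨ +-comm (k′ * r) r ⟩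
    suc k′ * r           ≡⟨ sym window ⟩
    hmin + (2 + q)       ≡⟨ cong (_+ (2 + q)) hmin≡ ⟩
    k′ * r + e + (2 + q) ≡⟨ +-assoc (k′ * r) e (2 + q) ⟩
    k′ * r + (e + (2 + q)) ∎)
    where open ≡-Reasoning

formula-identity : ∀ (K E P T : ℤ) →
  K ℤ.* (E ℤ.+ P) ℤ.* ((ℤ.1ℤ ℤ.+ K) ℤ.- K)
  ℤ.+ ((K ℤ.* (E ℤ.+ P) ℤ.+ E) ℤ.- K ℤ.* (E ℤ.+ P)) ℤ.* ((ℤ.1ℤ ℤ.+ K) ℤ.- + 2 ℤ.* K ℤ.- ℤ.1ℤ)
  ℤ.+ T ≡ T ℤ.+ K ℤ.* P
formula-identity = ℤ-Ring.solve-∀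

formula-in-window : ∀ {m₁ r hmin t n} k′ e p → m₁ ≡ k′ → r ≡ e + p → hmin ≡ k′ * r + e →
  + n ≡ (+ m₁ ℤ.* + r ℤ.* (+ suc k′ ℤ.- + m₁))
        ℤ.+ (+ hmin ℤ.- + m₁ ℤ.* + r) ℤ.* (+ suc k′ ℤ.- + 2 ℤ.* + m₁ ℤ.- + 1)
        ℤ.+ + t →
  n ≡ t + k′ * p
formula-in-window {t = t} {n} k′ e p refl refl refl eq = ℤₚ.+-injective (begin
  + n                                             ≡⟨ eq ⟩
  F (+ (e + p)) (+ (k′ * (e + p) + e))            ≡⟨ cong₂ F (ℤₚ.pos-+ e p) hmin≡ ⟩
  F (+ e ℤ.+ + p) (+ k′ ℤ.* (+ e ℤ.+ + p) ℤ.+ + e) ≡⟨ formula-identity (+ k′) (+ e) (+ p) (+ t) ⟩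
  + t ℤ.+ + k′ ℤ.* + p
    ≡⟨ sym (trans (ℤₚ.pos-+ t (k′ * p)) (cong (ℤ._+_ (+ t)) (ℤₚ.pos-* k′ p))) ⟩
  + (t + k′ * p)                                  ∎)
  where
  open ≡-Reasoning
  F : ℤ → ℤ → ℤ
  F R Hm = (+ k′ ℤ.* R ℤ.* (+ suc k′ ℤ.- + k′))
           ℤ.+ (Hm ℤ.- + k′ ℤ.* R) ℤ.* (+ suc k′ ℤ.- + 2 ℤ.* + k′ ℤ.- + 1) ℤ.+ + t
  hmin≡ : + (k′ * (e + p) + e) ≡ + k′ ℤ.* (+ e ℤ.+ + p) ℤ.+ + e
  hmin≡ = trans (ℤₚ.pos-+ (k′ * (e + p)) e)
            (cong (ℤ._+ + e) (trans (ℤₚ.pos-* k′ (e + p)) (cong (ℤ._*_ (+ k′)) (ℤₚ.pos-+ e p))))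

count-in-window : ∀ {k r hmin t n} q e .{{_ : NonZero r}} → 1 ≤ k →
  hmin ≡ (k ∸ 1) * r + e → r ≡ e + (2 + q) →
  + n ≡ (+ (hmin / r) ℤ.* + r ℤ.* (+ k ℤ.- + (hmin / r)))
        ℤ.+ (+ hmin ℤ.- + (hmin / r) ℤ.* + r) ℤ.* (+ k ℤ.- + 2 ℤ.* + (hmin / r) ℤ.- + 1)
        ℤ.+ + t →
  n ≡ t + (k ∸ 1) * (2 + q)
count-in-window {suc k′} {r} {hmin} q e (s≤s z≤n) hmin≡ r≡ = formula-in-window k′ e (2 + q) m₁≡ r≡ hmin≡
  where
  e<r : e < r
  e<r = subst (e <_) (sym r≡) (m<m+n e (s≤s z≤n))
  m₁≡ : hmin / r ≡ k′
  m₁≡ = trans (/-congˡ hmin≡) (trans (+-distrib-/-∣ˡ e (n∣m*n k′))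
          (trans (cong₂ _+_ (m*n/n≡m k′ r) (m<n⇒m/n≡0 e<r)) (+-identityʳ k′)))

corollary3p3 : (r : ℕ) → .{{_ : NonZero r}} → 2 ≤ r →
    (A : List ℕ) → Unique A → All (λ a → 1 ≤ a) A → 6 ≤ length A →
    (H : List ℕ) → Unique H → All (λ h → 1 ≤ h) H → 2 ≤ length H →
    (hmin : ℕ) → hmin ∈ H → All (λ h → hmin ≤ h) H →
    (amin : ℕ) → amin ∈ A → All (λ a → amin ≤ a) A →
    (length A ∸ 1) * r ∸ 1 < hmin →
    All (λ h → h < length A * r) H →
    (n : ℕ) → HasCard (InHSumset H r A) n →
    let k = length A
        t = length H
        m₁ = hmin / r
    in + n ≡ (+ m₁ ℤ.* + r ℤ.* (+ k ℤ.- + m₁))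
             ℤ.+ (+ hmin ℤ.- + m₁ ℤ.* + r) ℤ.* (+ k ℤ.- + 2 ℤ.* + m₁ ℤ.- + 1)
             ℤ.+ + t →
    ∃ λ d → (d ≤ r ∸ 1) × IsAP H d × IsAP A (d * amin)
corollary3p3 r _ A uA A≥1 6≤k H uH _ 2≤t hmin hmin∈H hmin≤H amin amin∈A amin≤A low H<kr n card count =
  let (h₂ , h₂∈H , h₂≢hmin) = another-element _≟_ uH 2≤t hmin
      (q , e , window , hmin≡ , r≡ , p≤r) =
        top-window-decomposition {length A} (∸1<⇒≤ low)
          (≤∧≢⇒< (All.lookup hmin≤H h₂∈H) (h₂≢hmin ∘ sym)) (All.lookup H<kr h₂∈H)
      n≡ = count-in-window q e (≤-trans (s≤s z≤n) 6≤k) hmin≡ r≡ count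
      (d , d<p , apH , apA) = inverse-in-top-window uA A≥1 (≤-trans (s≤s (s≤s z≤n)) 6≤k) amin∈A amin≤A
                                uH hmin∈H hmin≤H H<kr h₂∈H h₂≢hmin window p≤r card n≡
  in d , <⇒≤∸1 (<-≤-trans d<p p≤r) , apH , apA
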